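{- Let $\mathcal M=(W,W^\bot,\preccurlyeq,\sqsubseteq,V)$ be a forest-like bi-intuitionistic model of finite depth $n$ and let $\Sigma\subseteq\mathcal L$ be finite with $|\Sigma|=s$. Then $|W/\!\approx_\Sigma|\le 2^{2(n+1)s}_{n+2}$.
   Context: Language $\mathcal L$ over countably many propositional variables $\mathbb P$: $\varphi ::= p \mid \bot \mid \varphi\wedge\varphi\mid\varphi\vee\varphi\mid\varphi\to\varphi\mid\Diamond\varphi\mid\Box\varphi$. A bi-intuitionistic model $(W,W^\bot,\preccurlyeq,\sqsubseteq,V)$: $\preccurlyeq,\sqsubseteq$ preorders on $W$, $W^\bot\subseteq W$ closed upward under both, $V:\mathbb P\to2^W$ with each $V(p)$ $\preccurlyeq$-upward closed and containing $W^\bot$. Satisfaction: $w\models p$ iff $w\in V(p)$; $w\models\bot$ iff $w\in W^\bot$; $\wedge,\vee$ pointwise; $w\models\varphi\to\psi$ iff for all $v\succcurlyeq w$, $v\models\varphi$ implies $v\models\psi$; $w\models\Diamond\varphi$ iff for all $u\succcurlyeq w$ there is $v\sqsupseteq u$ with $v\models\varphi$; $w\models\Box\varphi$ iff for all $u,v$ with $w\preccurlyeq u\sqsubseteq v$, $v\models\varphi$. The model is forest-like if for every $w\in W$ the set $\{v: v\preccurlyeq w\}$ is totally ordered by $\preccurlyeq$. Write $w\prec v$ iff $w\preccurlyeq v$ and not $v\preccurlyeq w$. The depth of $w$ is the supremum in $\mathbb N\cup\{\infty\}$ of all $k$ such that there is a chain $w=w_0\prec\dots\prec w_k$; the depth of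 the model is the supremum of depths of its worlds. The $\Sigma$-label of $w$ is $\ell(w)=(\ell^+(w),\ell^\Diamond(w))$, $\ell^+(w)=\{\varphi\in\Sigma:w\models\varphi\}$, $\ell^\Diamond(w)=\{\varphi\in\Sigma:\forall v\,(w\sqsubseteq v\Rightarrow v\not\models\varphi)\}$. A relation $Z$ on $W$ is forth--up confluent if $w\preccurlyeq w'$, $w\mathrel Z v$ imply some $v'$ with $v\preccurlyeq v'$, $w'\mathrel Z v'$; back--up confluent if $w\mathrel Z v\preccurlyeq v'$ implies some $w'$ with $w\preccurlyeq w'\mathrel Z v'$; forth--down confluent if $w\preccurlyeq v\mathrel Z v'$ implies some $w'$ with $w\mathrel Z w'\preccurlyeq v'$. A strong $\Sigma$-bisimulation is a forth--up and back--up confluent $Z$ with $w\mathrel Zv\Rightarrow\ell(w)=\ell(v)$ such that both $Z$ and $Z^{ -1}$ are forth--down confluent. $\approx_\Sigma$ is the greatest strong $\Sigma$-bisimulation (the union of all of them), an equivalence relation; $W/\!\approx_\Sigma$ is its set of classes. Superexponential function: $2^m_0=m$, $2^m_{k+1}=2^{2^m_k}$. -}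

module Defs where

open import Level using (Level; 0ℓ) renaming (suc to lsuc)
open import Data.Nat using (ℕ; zero; suc; _+_; _*_; _^_)
open import Data.Fin using (Fin; inject₁) renaming (suc to fsuc)
open import Data.List using (List; length)
open import Data.List.Membership.Propositional using (_∈_)
open import Data.List.Relation.Unary.Unique.Propositional using (Unique)
open import Data.Product using (Σ; ∃; ∃-syntax; _×_; _,_)
open import Data.Sum using (_⊎_)
open import Relation.Nullary using (¬_)
open import Relation.Binary.PropositionalEquality using (_≡_; _≢_)

data Formula : Set where
  var  : ℕ → Formula
  ⊥'   : Formula
  _∧'_ : Formula → Formula → Formula
  _∨'_ : Formula → Formula → Formula
  _⇒'_ : Formula → Formula → Formula
  ◇'   : Formula → Formula
  □'   : Formula → Formula

record Model : Set₁ where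
  field
    W      : Set
    Wbot   : W → Set
    _≼_    : W → W → Set
    _⊑_    : W → W → Set
    V      : ℕ → W → Set
    ≼-refl  : ∀ {w} → w ≼ w
    ≼-trans : ∀ {u v w} → u ≼ v → v ≼ w → u ≼ w
    ⊑-refl  : ∀ {w} → w ⊑ w
    ⊑-trans : ∀ {u v w} → u ⊑ v → v ⊑ w → u ⊑ w
    Wbot-≼-up : ∀ {w v} → Wbot w → w ≼ v → Wbot v
    Wbot-⊑-up : ∀ {w v} → Wbot w → w ⊑ v → Wbot v
    V-≼-up    : ∀ p {w v} → V p w → w ≼ v → V p v
    Wbot⊆V    : ∀ p {w} → Wbot w → V p w

module _ (M : Model) where
  open Model M

  _⊨_ : W → Formula → Set
  w ⊨ var p    = V p w
  w ⊨ ⊥'       = Wbot w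
  w ⊨ (φ ∧' ψ) = (w ⊨ φ) × (w ⊨ ψ)
  w ⊨ (φ ∨' ψ) = (w ⊨ φ) ⊎ (w ⊨ ψ)
  w ⊨ (φ ⇒' ψ) = ∀ v → w ≼ v → v ⊨ φ → v ⊨ ψ
  w ⊨ ◇' φ     = ∀ u → w ≼ u → ∃[ v ] (u ⊑ v × v ⊨ φ)
  w ⊨ □' φ     = ∀ u v → w ≼ u → u ⊑ v → v ⊨ φ

  ForestLike : Set
  ForestLike = ∀ w u v → u ≼ w → v ≼ w → (u ≼ v) ⊎ (v ≼ u)

  _≺_ : W → W → Set
  w ≺ v = (w ≼ v) × ¬ (v ≼ w)

  HasChain : ℕ → Set
  HasChain k = Σ (Fin (suc k) → W) λ f → ∀ (i : Fin k) → f (inject₁ i) ≺ f (fsuc i)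

  HasDepth : ℕ → Set
  HasDepth n = HasChain n × ¬ HasChain (suc n)

  LabelNeg : List Formula → Formula → W → Set
  LabelNeg Σ' φ w = ∀ v → w ⊑ v → ¬ (v ⊨ φ)

  SameLabel : List Formula → W → W → Set
  SameLabel Σ' w v =
    ∀ φ → φ ∈ Σ' →
      ((w ⊨ φ → v ⊨ φ) × (v ⊨ φ → w ⊨ φ)) ×
      ((LabelNeg Σ' φ w → LabelNeg Σ' φ v) × (LabelNeg Σ' φ v → LabelNeg Σ' φ w))

  ForthUp : (W → W → Set) → Set
  ForthUp Z = ∀ w w' v → w ≼ w' → Z w v → ∃[ v' ] (v ≼ v' × Z w' v')

  BackUp : (W → W → Set) → Set
  BackUp Z = ∀ w v v' → Z w v → v ≼ v' → ∃[ w' ] (w ≼ w' × Z w' v')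

  ForthDown : (W → W → Set) → Set
  ForthDown Z = ∀ w v v' → w ≼ v → Z v v' → ∃[ w' ] (Z w w' × w' ≼ v')

  StrongBisim : List Formula → (W → W → Set) → Set
  StrongBisim Σ' Z =
    ForthUp Z × BackUp Z ×
    (∀ w v → Z w v → SameLabel Σ' w v) ×
    ForthDown Z × ForthDown (λ a b → Z b a)

  _≈[_]_ : W → List Formula → W → Set₁
  w ≈[ Σ' ] v = ∃[ Z ] (StrongBisim Σ' Z × Z w v)

  -- |W/≈_Σ| ≤ N : among any N+1 worlds, two distinct indices are ≈_Σ-related
  QuotientCardLe : List Formula → ℕ → Set₁
  QuotientCardLe Σ' N =
    ∀ (f : Fin (suc N) → W) → ∃[ i ] ∃[ j ] (i ≢ j × f i ≈[ Σ' ] f j)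

tower : ℕ → ℕ → ℕ
tower zero    m = m
tower (suc k) m = 2 ^ tower k m

-- Using excluded middle, give each world its height: the length of the longest ≺-chain ending at it, at
-- most n. The k-type of a world records its ℓ⁺-label, the ℓ^◇-labels occurring in its cluster and, if k > 0,
-- the (k-1)-types occurring one height above it; its width is a (k+1)-fold exponential in s. Relate two
-- worlds when they have equal height and ℓ^◇-label and, for every j, their ancestors of height j have the
-- same (n ∸ j)-type. In a forest the ancestors of a given height are unique up to their cluster, so this is
-- a strong Σ-bisimulation: a step up from height j is matched using one level of the (n ∸ j)-type, and a
-- step inside a cluster through its ℓ^◇-labels. The class of a world is therefore determined by a bit
-- string made of its height, its ancestors' types and its ℓ^◇-label, of length at most
-- tower (n + 1) (2 (n + 1) s), and pigeonhole gives the bound.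

module Submission where

open import Defs hiding (_≺_; _⊨_)
open import Level using (0ℓ; lift; lower) renaming (suc to lsuc)
open import Axiom.ExcludedMiddle using (ExcludedMiddle)
open import Data.Bool using (Bool; true; false)
open import Data.Fin using (Fin; funToFin; finToFun; toℕ; fromℕ<; inject₁) renaming (zero to fzero; suc to fsuc)
open import Data.Fin.Properties using (2↔Bool; finToFun-funToFin; toℕ-fromℕ<; pigeonhole) renaming (<⇒≢ to <⇒≢ᶠ)
open import Data.List as List using (List; length; []; _∷_)
open import Data.List.Membership.Propositional using (_∈_)
open import Data.List.Relation.Unary.Any as Any using ()
open import Data.List.Relation.Unary.Any.Properties using (lookup-index)
open import Data.List.Relation.Unary.Unique.Propositional using (Unique)
open import Data.Nat using (ℕ; zero; suc; _+_; _*_; _∸_; _^_; _≤_; _<_; z≤n; s≤s; _≤?_; _<?_)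
open import Data.Nat.Properties
open import Data.Nat.Tactic.RingSolver using (solve-∀)
open import Data.Product using (Σ; ∃-syntax; _×_; _,_; proj₁)
open import Data.Sum using (inj₁; inj₂)
open import Data.Unit using (⊤; tt)
open import Data.Vec using (Vec; lookup; tabulate; _++_; replicate)
open import Data.Vec.Properties using (lookup∘tabulate; tabulate∘lookup; tabulate-cong; ++-injectiveˡ; ++-injectiveʳ)
open import Function using (_∘_; Inverse; _⇔_; mk⇔)
open import Relation.Nullary using (Dec; yes; no; does; ¬_; contradiction)
open import Relation.Nullary.Decidable using (map′; dec-true; dec-false; does-⇔)
open import Relation.Binary.Definitions using (tri<; tri≈; tri>)
open import Relation.Binary.PropositionalEquality

encode : ∀ {k} → Vec Bool k → Fin (2 ^ k)
encode v = funToFin (Inverse.from 2↔Bool ∘ lookup v)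

lookup-encode : ∀ {k} (v : Vec Bool k) i → Inverse.to 2↔Bool (finToFun (encode v) i) ≡ lookup v i
lookup-encode v i = trans (cong (Inverse.to 2↔Bool) (finToFun-funToFin (Inverse.from 2↔Bool ∘ lookup v) i))
                          (Inverse.strictlyInverseˡ 2↔Bool (lookup v i))

lookup-≗⇒≡ : ∀ {A : Set} {k} {u v : Vec A k} → (∀ i → lookup u i ≡ lookup v i) → u ≡ v
lookup-≗⇒≡ {u = u} {v} eq = trans (sym (tabulate∘lookup u)) (trans (tabulate-cong eq) (tabulate∘lookup v))

encode-injective : ∀ {k} {u v : Vec Bool k} → encode u ≡ encode v → u ≡ v
encode-injective {u = u} {v} eq = lookup-≗⇒≡ λ i →
  trans (sym (lookup-encode u i)) (trans (cong (λ c → Inverse.to 2↔Bool (finToFun c i)) eq) (lookup-encode v i))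

tabulate-≡⇒≗ : ∀ {A : Set} {k} {f g : Fin k → A} → tabulate f ≡ tabulate g → ∀ i → f i ≡ g i
tabulate-≡⇒≗ {f = f} {g} eq i =
  trans (sym (lookup∘tabulate f i)) (trans (cong (λ v → lookup v i) eq) (lookup∘tabulate g i))

unary : (n m : ℕ) → Vec Bool n
unary n m = tabulate λ i → does (toℕ i <? m)

unary-separates : ∀ {n m m'} → m < m' → m' ≤ n → unary n m ≢ unary n m'
unary-separates {n} {m} {m'} m<m' m'≤n eq =
  contradiction (trans (sym (dec-false (toℕ i <? m) (λ i<m → <-irrefl i≡m i<m)))
                       (trans (tabulate-≡⇒≗ eq i) (dec-true (toℕ i <? m') (subst (_< m') (sym i≡m) m<m')))) λ ()
  where
  i = fromℕ< (≤-trans m<m' m'≤n)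
  i≡m = toℕ-fromℕ< (≤-trans m<m' m'≤n)

unary-injective : ∀ {n m m'} → m ≤ n → m' ≤ n → unary n m ≡ unary n m' → m ≡ m'
unary-injective {m = m} {m'} m≤n m'≤n eq with <-cmp m m'
... | tri< m<m' _ _ = contradiction eq (unary-separates m<m' m'≤n)
... | tri≈ _ m≡m' _ = m≡m'
... | tri> _ _ m'<m = contradiction (sym eq) (unary-separates m'<m m≤n)

em⇒decide : ExcludedMiddle (lsuc 0ℓ) → (P : Set) → Dec P
em⇒decide em P = map′ lower lift em

module Classical (decide : (P : Set) → Dec P) where

  truth : Set → Bool
  truth P = does (decide P)

  truth-intro : ∀ {P} → P → truth P ≡ true
  truth-intro = dec-true (decide _)

  truth-elim : ∀ {P} → truth P ≡ true → P
  truth-elim {P} eq with decide P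
  ... | yes p = p

  truth-cong : ∀ {P Q} → P ⇔ Q → truth P ≡ truth Q
  truth-cong P⇔Q = does-⇔ P⇔Q (decide _) (decide _)

  truth-transport : ∀ {P Q} → truth P ≡ truth Q → P → Q
  truth-transport eq p = truth-elim (trans (sym eq) (truth-intro p))

  module Greatest {P : ℕ → Set} (P₀ : P zero) where

    greatest : ℕ → ℕ
    greatest zero = zero
    greatest (suc k) with decide (P (suc k))
    ... | yes _ = suc k
    ... | no  _ = greatest k

    greatest-holds : ∀ k → P (greatest k)
    greatest-holds zero = P₀
    greatest-holds (suc k) with decide (P (suc k))
    ... | yes p = p
    ... | no  _ = greatest-holds k

    greatest-≤ : ∀ k → greatest k ≤ k
    greatest-≤ zero = z≤n
    greatest-≤ (suc k) with decide (P (suc k))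
    ... | yes _ = ≤-refl
    ... | no  _ = ≤-trans (greatest-≤ k) (n≤1+n k)

    greatest-maximal : ∀ {j k} → j ≤ k → P j → j ≤ greatest k
    greatest-maximal {k = zero} z≤n _ = z≤n
    greatest-maximal {j} {suc k} j≤k p with decide (P (suc k)) | m≤n⇒m<n∨m≡n j≤k
    ... | yes _ | _         = j≤k
    ... | no  _ | inj₁ j<k  = greatest-maximal (≤-pred j<k) p
    ... | no ¬p | inj₂ refl = contradiction p ¬p

typeWidth : ℕ → ℕ → ℕ
typeWidth s zero    = s + 2 ^ s
typeWidth s (suc k) = typeWidth s zero + 2 ^ typeWidth s k

slotsWidth : ℕ → ℕ → ℕ
slotsWidth s zero    = typeWidth s zero
slotsWidth s (suc k) = typeWidth s (suc k) + slotsWidth s k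

codeWidth : ℕ → ℕ → ℕ
codeWidth s n = n + (slotsWidth s n + s)

2^[1+n]≡2^n+2^n : ∀ n → 2 ^ suc n ≡ 2 ^ n + 2 ^ n
2^[1+n]≡2^n+2^n n = cong (2 ^ n +_) (+-identityʳ (2 ^ n))

n<2^n : ∀ n → n < 2 ^ n
n<2^n zero    = s≤s z≤n
n<2^n (suc n) = ≤-trans (+-mono-≤ (m^n>0 2 n) (n<2^n n)) (≤-reflexive (sym (2^[1+n]≡2^n+2^n n)))

tower-monoʳ-≤ : ∀ k {x y} → x ≤ y → tower k x ≤ tower k y
tower-monoʳ-≤ zero    x≤y = x≤y
tower-monoʳ-≤ (suc k) x≤y = ^-monoʳ-≤ 2 (tower-monoʳ-≤ k x≤y)

tower-monoʳ-< : ∀ k {x y} → x < y → tower k x < tower k y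
tower-monoʳ-< zero    x<y = x<y
tower-monoʳ-< (suc k) x<y = ^-monoʳ-< 2 (s≤s (s≤s z≤n)) (tower-monoʳ-< k x<y)

1+x+[x+2^x]≤2^[2+x] : ∀ x → suc (x + (x + 2 ^ x)) ≤ 2 ^ suc (suc x)
1+x+[x+2^x]≤2^[2+x] x = begin
  suc (x + (x + 2 ^ x))         ≤⟨ +-mono-≤ (n<2^n x) (+-monoˡ-≤ (2 ^ x) (<⇒≤ (n<2^n x))) ⟩
  2 ^ x + (2 ^ x + 2 ^ x)       ≤⟨ m≤n+m _ (2 ^ x) ⟩
  2 ^ x + (2 ^ x + (2 ^ x + 2 ^ x)) ≡⟨ regroup (2 ^ x) ⟩
  (2 ^ x + 2 ^ x) + (2 ^ x + 2 ^ x) ≡⟨ cong₂ _+_ (2^[1+n]≡2^n+2^n x) (2^[1+n]≡2^n+2^n x) ⟨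
  2 ^ suc x + 2 ^ suc x         ≡⟨ 2^[1+n]≡2^n+2^n (suc x) ⟨
  2 ^ suc (suc x)               ∎
  where
  open ≤-Reasoning
  regroup : ∀ p → p + (p + (p + p)) ≡ (p + p) + (p + p)
  regroup = solve-∀

typeWidth₀≤slotsWidth : ∀ s k → typeWidth s zero ≤ slotsWidth s k
typeWidth₀≤slotsWidth s zero    = ≤-refl
typeWidth₀≤slotsWidth s (suc k) = ≤-trans (typeWidth₀≤slotsWidth s k) (m≤n+m _ _)

typeWidth≤slotsWidth : ∀ s k → typeWidth s k ≤ slotsWidth s k
typeWidth≤slotsWidth s zero    = ≤-refl
typeWidth≤slotsWidth s (suc k) = m≤m+n _ _

codeWidth≤tower[2s+2k] : ∀ t k → codeWidth (suc t) k ≤ tower (suc k) (2 * suc t + 2 * k)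
codeWidth≤tower[2s+2k] t zero = begin
  (s + 2 ^ s) + s     ≡⟨ rearrange s (2 ^ s) ⟩
  2 ^ s + 2 * s       ≤⟨ +-monoʳ-≤ (2 ^ s) (*-monoʳ-≤ 2 (n<2^n t)) ⟩
  2 ^ s + 2 ^ s       ≡⟨ 2^[1+n]≡2^n+2^n s ⟨
  2 ^ suc s           ≤⟨ ^-monoʳ-≤ 2 (≤-trans (+-monoˡ-≤ s (s≤s z≤n)) (≤-reflexive (s+s≡2s+0 s))) ⟩
  2 ^ (2 * s + 2 * 0) ∎
  where
  open ≤-Reasoning
  s = suc t
  rearrange : ∀ s p → (s + p) + s ≡ p + 2 * s
  rearrange = solve-∀
  s+s≡2s+0 : ∀ s → s + s ≡ 2 * s + 2 * 0
  s+s≡2s+0 = solve-∀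
codeWidth≤tower[2s+2k] t (suc k) = begin
  codeWidth s (suc k)                   ≡⟨ rearrange k b₀ (2 ^ bₖ) (slotsWidth s k) s ⟩
  suc (A + (b₀ + 2 ^ bₖ))               ≤⟨ s≤s (+-mono-≤ A≤X (+-mono-≤ b₀≤X (^-monoʳ-≤ 2 bₖ≤X))) ⟩
  suc (X + (X + 2 ^ X))                 ≤⟨ 1+x+[x+2^x]≤2^[2+x] X ⟩
  2 ^ suc (suc X)                       ≤⟨ ^-monoʳ-≤ 2 (≤-trans (s≤s (tower-monoʳ-< (suc k) ≤-refl))
                                                             (tower-monoʳ-< (suc k) ≤-refl)) ⟩
  2 ^ tower (suc k) (suc (suc m))       ≡⟨ cong (λ m → 2 ^ tower (suc k) m) (2+2s+2k≡2s+2[1+k] s k) ⟩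
  tower (suc (suc k)) (2 * s + 2 * suc k) ∎
  where
  open ≤-Reasoning
  s = suc t
  b₀ = typeWidth s zero
  bₖ = typeWidth s k
  A = codeWidth s k
  m = 2 * s + 2 * k
  X = tower (suc k) m
  A≤X : A ≤ X
  A≤X = codeWidth≤tower[2s+2k] t k
  slots≤X : slotsWidth s k ≤ X
  slots≤X = ≤-trans (≤-trans (m≤m+n _ s) (m≤n+m _ k)) A≤X
  b₀≤X = ≤-trans (typeWidth₀≤slotsWidth s k) slots≤X
  bₖ≤X = ≤-trans (typeWidth≤slotsWidth s k) slots≤X
  rearrange : ∀ k b p S s → suc k + ((b + p + S) + s) ≡ suc (k + (S + s) + (b + p))
  rearrange = solve-∀
  2+2s+2k≡2s+2[1+k] : ∀ s k → suc (suc (2 * s + 2 * k)) ≡ 2 * s + 2 * suc k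
  2+2s+2k≡2s+2[1+k] = solve-∀

codeWidth≤tower : ∀ t n → codeWidth (suc t) n ≤ tower (suc n) (2 * (n + 1) * suc t)
codeWidth≤tower t n = ≤-trans (codeWidth≤tower[2s+2k] t n) (tower-monoʳ-≤ (suc n) 2s+2n≤2[n+1]s)
  where
  s = suc t
  distrib : ∀ s n → 2 * s + 2 * (n * s) ≡ 2 * (n + 1) * s
  distrib = solve-∀
  2s+2n≤2[n+1]s : 2 * s + 2 * n ≤ 2 * (n + 1) * s
  2s+2n≤2[n+1]s = ≤-trans (+-monoʳ-≤ (2 * s) (*-monoʳ-≤ 2 (m≤m*n n s))) (≤-reflexive (distrib s n))

2^≤tower[n+2] : ∀ n {x m} → x ≤ tower (suc n) m → 2 ^ x ≤ tower (n + 2) m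
2^≤tower[n+2] n {x} {m} x≤t = subst (2 ^ x ≤_) (cong (λ k → tower k m) (+-comm 2 n)) (^-monoʳ-≤ 2 x≤t)

module Height (decide : (P : Set) → Dec P) (M : Model) (n : ℕ) (no-long-chain : ¬ HasChain M (suc n)) where
  open Model M
  open Classical decide

  _≺_ : W → W → Set
  _≺_ = Defs._≺_ M

  ≼-≺-trans : ∀ {a b c} → a ≼ b → b ≺ c → a ≺ c
  ≼-≺-trans a≼b (b≼c , c⋠b) = ≼-trans a≼b b≼c , λ c≼a → c⋠b (≼-trans c≼a a≼b)

  Chain : ℕ → W → W → Set
  Chain zero    x y = x ≼ y
  Chain (suc k) x y = ∃[ z ] (x ≺ z × Chain k z y)

  chain⇒≼ : ∀ k {x y} → Chain k x y → x ≼ y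
  chain⇒≼ zero    x≼y             = x≼y
  chain⇒≼ (suc k) (z , x≺z , c) = ≼-trans (proj₁ x≺z) (chain⇒≼ k c)

  chain-extendʳ : ∀ k {x y y'} → Chain k x y → y ≼ y' → Chain k x y'
  chain-extendʳ zero    x≼y           y≼y' = ≼-trans x≼y y≼y'
  chain-extendʳ (suc k) (z , x≺z , c) y≼y' = z , x≺z , chain-extendʳ k c y≼y'

  chain-snoc : ∀ k {x y y'} → Chain k x y → y ≺ y' → Chain (suc k) x y'
  chain-snoc zero    x≼y           y≺y' = _ , ≼-≺-trans x≼y y≺y' , ≼-refl
  chain-snoc (suc k) (z , x≺z , c) y≺y' = z , x≺z , chain-snoc k c y≺y'

  chain-shorten : ∀ {j k x y} → j ≤ k → Chain k x y → Chain j x y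
  chain-shorten {k = k} z≤n c                   = chain⇒≼ k c
  chain-shorten         (s≤s j≤k) (z , x≺z , c) = z , x≺z , chain-shorten j≤k c

  chain-split : ∀ j l {x y} → Chain (j + l) x y → ∃[ a ] (Chain j x a × Chain l a y)
  chain-split zero    l {x} c           = x , ≼-refl , c
  chain-split (suc j) l (z , x≺z , c) with chain-split j l c
  ... | a , c₁ , c₂ = a , (z , x≺z , c₁) , c₂

  chain⇒HasChain : ∀ k {x y} → Chain k x y → Σ (HasChain M k) λ (f , _) → f fzero ≡ x
  chain⇒HasChain zero    {x} _             = ((λ _ → x) , λ ()) , refl
  chain⇒HasChain (suc k) {x} (z , x≺z , c) with chain⇒HasChain k c
  ... | (f , f-chain) , refl = (cons , cons-chain) , refl
    where
    cons : Fin (suc (suc k)) → W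
    cons fzero    = x
    cons (fsuc i) = f i
    cons-chain : ∀ i → cons (inject₁ i) ≺ cons (fsuc i)
    cons-chain fzero    = x≺z
    cons-chain (fsuc i) = f-chain i

  chain-bound : ∀ k {x y} → Chain k x y → k ≤ n
  chain-bound k c with k ≤? n
  ... | yes k≤n = k≤n
  ... | no  k≰n = contradiction (proj₁ (chain⇒HasChain (suc n) (chain-shorten (≰⇒> k≰n) c))) no-long-chain

  ChainBelow : W → ℕ → Set
  ChainBelow w k = ∃[ x ] Chain k x w

  module Search (w : W) = Greatest {ChainBelow w} (w , ≼-refl)

  opaque
    height : W → ℕ
    height w = Search.greatest w n

    height-≤ : ∀ w → height w ≤ n
    height-≤ w = Search.greatest-≤ w n

    height-chain : ∀ w → ChainBelow w (height w)
    height-chain w = Search.greatest-holds w n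

    height-maximal : ∀ {k x w} → Chain k x w → k ≤ height w
    height-maximal {k} {x} {w} c = Search.greatest-maximal w (chain-bound k c) (x , c)

  height-mono : ∀ {a w} → a ≼ w → height a ≤ height w
  height-mono {a} a≼w with height-chain a
  ... | _ , c = height-maximal (chain-extendʳ (height a) c a≼w)

  height-strict : ∀ {a w} → a ≺ w → suc (height a) ≤ height w
  height-strict {a} a≺w with height-chain a
  ... | _ , c = height-maximal (chain-snoc (height a) c a≺w)

  chain-height : ∀ l {a y} → Chain l a y → l + height a ≤ height y
  chain-height zero    a≼y           = height-mono a≼y
  chain-height (suc l) (z , a≺z , c) =
    ≤-trans (≤-reflexive (sym (+-suc l _))) (≤-trans (+-monoʳ-≤ l (height-strict a≺z)) (chain-height l c))

  ≼-by-height : ∀ {a w} → a ≼ w → height a ≡ height w → w ≼ a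
  ≼-by-height {a} {w} a≼w eq with decide (w ≼ a)
  ... | yes w≼a = w≼a
  ... | no  w⋠a = contradiction (height-strict (a≼w , w⋠a)) (<-irrefl eq)

  ancestor-at : ∀ {w} j → j ≤ height w → ∃[ a ] (a ≼ w × height a ≡ j)
  ancestor-at {w} j j≤h with height-chain w
  ... | x , c with chain-split j (height w ∸ j) (subst (λ k → Chain k x w) (sym (m+[n∸m]≡n j≤h)) c)
  ...   | a , c₁ , c₂ = a , chain⇒≼ (height w ∸ j) c₂ , ≤-antisym a≤j (height-maximal c₁)
    where
    a≤j : height a ≤ j
    a≤j = +-cancelˡ-≤ (height w ∸ j) (height a) j (≤-trans (chain-height _ c₂)
            (≤-reflexive (trans (sym (m+[n∸m]≡n j≤h)) (+-comm j _))))

module Bisimulation (decide : (P : Set) → Dec P) (M : Model) (forest : ForestLike M)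
                    (n : ℕ) (no-long-chain : ¬ HasChain M (suc n)) (Σ' : List Formula) where
  open Model M
  open Classical decide
  open Height decide M n no-long-chain

  _⊨_ : W → Formula → Set
  _⊨_ = Defs._⊨_ M

  persistence : ∀ φ {w v} → w ⊨ φ → w ≼ v → v ⊨ φ
  persistence (var p)  w⊨p     w≼v = V-≼-up p w⊨p w≼v
  persistence ⊥'       w⊨⊥     w≼v = Wbot-≼-up w⊨⊥ w≼v
  persistence (φ ∧' ψ) (a , b) w≼v = persistence φ a w≼v , persistence ψ b w≼v
  persistence (φ ∨' ψ) (inj₁ a) w≼v = inj₁ (persistence φ a w≼v)
  persistence (φ ∨' ψ) (inj₂ b) w≼v = inj₂ (persistence ψ b w≼v)
  persistence (φ ⇒' ψ) w⊨φ⇒ψ  w≼v = λ u v≼u → w⊨φ⇒ψ u (≼-trans w≼v v≼u)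
  persistence (◇' φ)   w⊨◇φ   w≼v = λ u v≼u → w⊨◇φ u (≼-trans w≼v v≼u)
  persistence (□' φ)   w⊨□φ   w≼v = λ u u' v≼u → w⊨□φ u u' (≼-trans w≼v v≼u)

  ancestors-by-height : ∀ {a b x} → a ≼ x → b ≼ x → height a ≤ height b → a ≼ b
  ancestors-by-height {a} {b} {x} a≼x b≼x ha≤hb with forest x a b a≼x b≼x
  ... | inj₁ a≼b = a≼b
  ... | inj₂ b≼a = ≼-by-height b≼a (≤-antisym (height-mono b≼a) ha≤hb)

  step-between : ∀ {w w'} → w ≼ w' → suc (height w) ≤ height w' →
                 ∃[ z ] (w ≼ z × z ≼ w' × height z ≡ suc (height w))
  step-between {w} w≼w' hw<hw' with ancestor-at (suc (height w)) hw<hw'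
  ... | z , z≼w' , hz = z , ancestors-by-height w≼w' z≼w' (≤-trans (n≤1+n _) (≤-reflexive (sym hz))) , z≼w' , hz

  s : ℕ
  s = length Σ'

  bitsOf : (Formula → Set) → Vec Bool s
  bitsOf P = tabulate λ i → truth (P (List.lookup Σ' i))

  bitsOf-transport : ∀ (P Q : Formula → Set) → bitsOf P ≡ bitsOf Q → ∀ {φ} → φ ∈ Σ' → P φ → Q φ
  bitsOf-transport P Q eq φ∈Σ p =
    subst Q (sym φ≡) (truth-transport (tabulate-≡⇒≗ eq (Any.index φ∈Σ)) (subst P φ≡ p))
    where φ≡ = lookup-index φ∈Σ

  labelBits : W → Vec Bool s
  labelBits x = bitsOf (x ⊨_)

  negBits : W → Vec Bool s
  negBits x = bitsOf (λ φ → LabelNeg M Σ' φ x)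

  -- Offset 0 ranges over the cluster of x, offset 1 over the worlds one height above it.
  codesAbove : ∀ {m} → ℕ → (W → Fin m) → W → Vec Bool m
  codesAbove o code x = tabulate λ c → truth (∃[ y ] (x ≼ y × height y ≡ o + height x × code y ≡ c))

  codesAbove-transport : ∀ {m} o (code : W → Fin m) {x x' y} → codesAbove o code x ≡ codesAbove o code y →
                         x ≼ x' → height x' ≡ o + height x →
                         ∃[ y' ] (y ≼ y' × height y' ≡ o + height y × code y' ≡ code x')
  codesAbove-transport o code eq x≼x' hx' = truth-transport (tabulate-≡⇒≗ eq (code _)) (_ , x≼x' , hx' , refl)

  codesAbove-cluster-invariant : ∀ {m} o (code : W → Fin m) {x y} → x ≼ y → y ≼ x →
                                 codesAbove o code x ≡ codesAbove o code y
  codesAbove-cluster-invariant o code {x} {y} x≼y y≼x =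
    tabulate-cong λ c → truth-cong (mk⇔ (move y≼x hx≡hy) (move x≼y (sym hx≡hy)))
    where
    hx≡hy = ≤-antisym (height-mono x≼y) (height-mono y≼x)
    move : ∀ {x y c} → y ≼ x → height x ≡ height y →
           ∃[ z ] (x ≼ z × height z ≡ o + height x × code z ≡ c) →
           ∃[ z ] (y ≼ z × height z ≡ o + height y × code z ≡ c)
    move y≼x hx≡hy (z , x≼z , hz , cz) = z , ≼-trans y≼x x≼z , trans hz (cong (o +_) hx≡hy) , cz

  labelBits-cluster-invariant : ∀ {x y} → x ≼ y → y ≼ x → labelBits x ≡ labelBits y
  labelBits-cluster-invariant x≼y y≼x = tabulate-cong λ i →
    let φ = List.lookup Σ' i in truth-cong (mk⇔ (λ p → persistence φ p x≼y) (λ p → persistence φ p y≼x))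

  type : (k : ℕ) → W → Vec Bool (typeWidth s k)
  type zero    x = labelBits x ++ codesAbove 0 (encode ∘ negBits) x
  type (suc k) x = type zero x ++ codesAbove 1 (encode ∘ type k) x

  type⇒type₀ : ∀ k {x y} → type k x ≡ type k y → type zero x ≡ type zero y
  type⇒type₀ zero    eq = eq
  type⇒type₀ (suc k) eq = ++-injectiveˡ _ _ eq

  type-cluster-invariant : ∀ k {x y} → x ≼ y → y ≼ x → type k x ≡ type k y
  type-cluster-invariant zero    x≼y y≼x =
    cong₂ _++_ (labelBits-cluster-invariant x≼y y≼x) (codesAbove-cluster-invariant 0 _ x≼y y≼x)
  type-cluster-invariant (suc k) x≼y y≼x =
    cong₂ _++_ (type-cluster-invariant zero x≼y y≼x) (codesAbove-cluster-invariant 1 _ x≼y y≼x)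

  type-by-height : ∀ k {a x} → a ≼ x → height a ≡ height x → type k a ≡ type k x
  type-by-height k a≼x eq = type-cluster-invariant k a≼x (≼-by-height a≼x eq)

  -- An ancestor of height j needs only its (n ∸ j)-type: no chain above it has more than n ∸ j steps.
  AncestorsAgree : W → W → Set
  AncestorsAgree x y =
    ∀ {j a b} → a ≼ x → b ≼ y → height a ≡ j → height b ≡ j → type (n ∸ j) a ≡ type (n ∸ j) b

  ancestorsAgree-antitone : ∀ {x x' y y'} → x' ≼ x → y' ≼ y → AncestorsAgree x y → AncestorsAgree x' y'
  ancestorsAgree-antitone x'≼x y'≼y agree a≼x' b≼y' = agree (≼-trans a≼x' x'≼x) (≼-trans b≼y' y'≼y)

  record Related (x y : W) : Set where
    field
      height-≡  : height x ≡ height y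
      negBits-≡ : negBits x ≡ negBits y
      ancestors : AncestorsAgree x y

  open Related

  Related-sym : ∀ {x y} → Related x y → Related y x
  Related-sym x~y = record
    { height-≡  = sym (height-≡ x~y)
    ; negBits-≡ = sym (negBits-≡ x~y)
    ; ancestors = λ a≼y b≼x ha hb → sym (ancestors x~y b≼x a≼y hb ha)
    }

  own-type : ∀ {x y} → Related x y → type (n ∸ height x) x ≡ type (n ∸ height x) y
  own-type x~y = ancestors x~y ≼-refl ≼-refl refl (sym (height-≡ x~y))

  realign : ∀ {x y} → height x ≡ height y → AncestorsAgree x y → ∃[ y' ] (y ≼ y' × y' ≼ y × Related x y')
  realign {x} {y} hx≡hy agree =
    let y' , y≼y' , hy' , neg≡ = codesAbove-transport 0 (encode ∘ negBits) (++-injectiveʳ _ _ types₀≡) ≼-refl refl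
        y'≼y = ≼-by-height y≼y' (sym hy')
    in y' , y≼y' , y'≼y , record
      { height-≡  = trans hx≡hy (sym hy')
      ; negBits-≡ = sym (encode-injective neg≡)
      ; ancestors = ancestorsAgree-antitone ≼-refl y'≼y agree
      }
    where types₀≡ = type⇒type₀ (n ∸ height x) (agree ≼-refl ≼-refl refl (sym hx≡hy))

  same-label : ∀ {x y} → Related x y → SameLabel M Σ' x y
  same-label {x} {y} x~y φ φ∈Σ =
    (bitsOf-transport (x ⊨_) (y ⊨_) labels φ∈Σ , bitsOf-transport (y ⊨_) (x ⊨_) (sym labels) φ∈Σ) ,
    (bitsOf-transport (Neg x) (Neg y) (negBits-≡ x~y) φ∈Σ ,
     bitsOf-transport (Neg y) (Neg x) (sym (negBits-≡ x~y)) φ∈Σ)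
    where
    labels : labelBits x ≡ labelBits y
    labels = ++-injectiveˡ _ _ (type⇒type₀ (n ∸ height x) (own-type x~y))
    Neg : W → Formula → Set
    Neg w φ = LabelNeg M Σ' φ w

  forth-down : ∀ {w v v'} → w ≼ v → Related v v' → ∃[ w' ] (Related w w' × w' ≼ v')
  forth-down {w} w≼v v~v' =
    let b , b≼v' , hb = ancestor-at (height w) (subst (height w ≤_) (height-≡ v~v') (height-mono w≼v))
        w' , _ , w'≼b , w~w' = realign (sym hb) (ancestorsAgree-antitone w≼v b≼v' (ancestors v~v'))
    in w' , w~w' , ≼-trans w'≼b b≼v'

  -- By forest-likeness the ancestors of z of height ≤ height w are ancestors of w; the only other height
  -- is that of z itself.
  ancestorsAgree-step : ∀ {w v z z'} → Related w v → w ≼ z → v ≼ z' →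
                        height z ≡ suc (height w) → height z' ≡ height z →
                        type (n ∸ height z) z ≡ type (n ∸ height z) z' → AncestorsAgree z z'
  ancestorsAgree-step {w} {v} {z} w~v w≼z v≼z' hz hz' top {j} {a} {b} a≼z b≼z' ha hb with j ≤? height w
  ... | yes j≤hw = ancestors w~v (ancestors-by-height a≼z w≼z (≤-trans (≤-reflexive ha) j≤hw))
                                 (ancestors-by-height b≼z' v≼z' (≤-trans (≤-reflexive hb) (subst (j ≤_) (height-≡ w~v) j≤hw)))
                                 ha hb
  ... | no  j≰hw with ≤-antisym (subst (_≤ height z) ha (height-mono a≼z)) (subst (_≤ j) (sym hz) (≰⇒> j≰hw))
  ...   | refl = trans (type-by-height (n ∸ height z) a≼z ha)
                       (trans top (sym (type-by-height (n ∸ height z) b≼z' (trans hb (sym hz')))))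

  step-up : ∀ {w v z} → Related w v → w ≼ z → height z ≡ suc (height w) → ∃[ z' ] (v ≼ z' × Related z z')
  step-up {w} {v} {z} w~v w≼z hz =
    let z₁ , v≼z₁ , hz₁ , code≡ = codesAbove-transport 1 (encode ∘ type k) (++-injectiveʳ _ _ types≡) w≼z hz
        hz≡hz₁ = trans hz (trans (cong suc (height-≡ w~v)) (sym hz₁))
        z' , z₁≼z' , _ , z~z' =
          realign hz≡hz₁ (ancestorsAgree-step w~v w≼z v≼z₁ hz (sym hz≡hz₁) (sym (encode-injective code≡)))
    in z' , ≼-trans v≼z₁ z₁≼z' , z~z'
    where
    k = n ∸ height z
    n∸hw≡1+k : n ∸ height w ≡ suc k
    n∸hw≡1+k = trans (+-∸-assoc 1 (subst (_≤ n) hz (height-≤ z))) (cong (λ h → suc (n ∸ h)) (sym hz))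
    types≡ : type (suc k) w ≡ type (suc k) v
    types≡ = subst (λ i → type i w ≡ type i v) n∸hw≡1+k (own-type w~v)

  forth-same-height : ∀ {w w' v} → Related w v → w ≼ w' → height w' ≡ height w →
                      ∃[ v' ] (v ≼ v' × Related w' v')
  forth-same-height w~v w≼w' hw' =
    let v' , v≼v' , _ , w'~v' =
          realign (trans hw' (height-≡ w~v))
                  (ancestorsAgree-antitone (≼-by-height w≼w' (sym hw')) ≼-refl (ancestors w~v))
    in v' , v≼v' , w'~v'

  forth-up-by : ∀ g {w w' v} → w ≼ w' → height w' ≡ g + height w → Related w v →
                ∃[ v' ] (v ≼ v' × Related w' v')
  forth-up-by zero    w≼w' hw' w~v = forth-same-height w~v w≼w' hw'
  forth-up-by (suc g) {w} w≼w' hw' w~v =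
    let z , w≼z , z≼w' , hz = step-between w≼w' (subst (suc (height w) ≤_) (sym hw') (s≤s (m≤n+m (height w) g)))
        z' , v≼z' , z~z'     = step-up w~v w≼z hz
        v' , z'≼v' , w'~v'   = forth-up-by g z≼w' (trans hw' (trans (sym (+-suc g (height w))) (cong (g +_) (sym hz)))) z~z'
    in v' , ≼-trans v≼z' z'≼v' , w'~v'

  forth-up : ∀ {w w' v} → w ≼ w' → Related w v → ∃[ v' ] (v ≼ v' × Related w' v')
  forth-up w≼w' = forth-up-by _ w≼w' (sym (m∸n+n≡m (height-mono w≼w')))

  related-strongBisim : StrongBisim M Σ' Related
  related-strongBisim =
    (λ _ _ _ → forth-up) ,
    (λ _ _ _ w~v v≼v' → let w' , w≼w' , v'~w' = forth-up v≼v' (Related-sym w~v) in w' , w≼w' , Related-sym v'~w') ,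
    (λ _ _ → same-label) ,
    (λ _ _ _ → forth-down) ,
    (λ _ _ _ w≼v v'~v → let w' , w~w' , w'≼v' = forth-down w≼v (Related-sym v'~v) in w' , Related-sym w~w' , w'≼v')

  -- The junk value for a missing ancestor is never inspected: code-≡⇒Related only reads slots of heights
  -- at most height x.
  slot : (k : ℕ) → W → Vec Bool (typeWidth s k)
  slot k x with decide (∃[ a ] (a ≼ x × height a ≡ n ∸ k))
  ... | yes (a , _) = type k a
  ... | no  _       = replicate _ false

  slot-at : ∀ k {a x} → a ≼ x → height a ≡ n ∸ k → slot k x ≡ type k a
  slot-at k {a} {x} a≼x ha with decide (∃[ a ] (a ≼ x × height a ≡ n ∸ k))
  ... | yes (b , b≼x , hb) = type-by-height k (ancestors-by-height b≼x a≼x (≤-reflexive hb≡ha)) hb≡ha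
    where hb≡ha = trans hb (sym ha)
  ... | no  none           = contradiction (a , a≼x , ha) none

  slots : (k : ℕ) → W → Vec Bool (slotsWidth s k)
  slots zero    x = slot zero x
  slots (suc k) x = slot (suc k) x ++ slots k x

  slots-≡⇒slot-≡ : ∀ k {x y} → slots k x ≡ slots k y → ∀ {j} → j ≤ k → slot j x ≡ slot j y
  slots-≡⇒slot-≡ zero    eq z≤n = eq
  slots-≡⇒slot-≡ (suc k) eq j≤1+k with m≤n⇒m<n∨m≡n j≤1+k
  ... | inj₁ j<1+k = slots-≡⇒slot-≡ k (++-injectiveʳ _ _ eq) (≤-pred j<1+k)
  ... | inj₂ refl  = ++-injectiveˡ _ _ eq

  code : W → Vec Bool (codeWidth s n)
  code x = unary n (height x) ++ (slots n x ++ negBits x)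

  code-≡⇒Related : ∀ {x y} → code x ≡ code y → Related x y
  code-≡⇒Related {x} {y} eq = record
    { height-≡  = unary-injective (height-≤ x) (height-≤ y) (++-injectiveˡ (unary n (height x)) (unary n (height y)) eq)
    ; negBits-≡ = ++-injectiveʳ (slots n x) (slots n y) rest
    ; ancestors = slots-agree
    }
    where
    rest = ++-injectiveʳ (unary n (height x)) (unary n (height y)) eq
    slots-agree : AncestorsAgree x y
    slots-agree {j} {a} {b} a≼x b≼y ha hb = begin
      type k a ≡⟨ slot-at k a≼x (trans ha j≡n∸k) ⟨
      slot k x ≡⟨ slots-≡⇒slot-≡ n (++-injectiveˡ (slots n x) (slots n y) rest) (m∸n≤m n j) ⟩
      slot k y ≡⟨ slot-at k b≼y (trans hb j≡n∸k) ⟩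
      type k b ∎
      where
      open ≡-Reasoning
      k = n ∸ j
      j≡n∸k : j ≡ n ∸ k
      j≡n∸k = sym (m∸[m∸n]≡n (subst (_≤ n) ha (height-≤ a)))

classes-bounded-by-code : ∀ {M Σ' N N'} {Z : Model.W M → Model.W M → Set} → StrongBisim M Σ' Z →
                          (code : Model.W M → Fin N) → (∀ {x y} → code x ≡ code y → Z x y) →
                          N ≤ N' → QuotientCardLe M Σ' N'
classes-bounded-by-code bisim code sound N≤N' f with pigeonhole (s≤s N≤N') (code ∘ f)
... | i , j , i<j , eq = i , j , <⇒≢ᶠ i<j , _ , bisim , sound eq

trivial-strongBisim : (M : Model) → StrongBisim M [] (λ _ _ → ⊤)
trivial-strongBisim M =
  (λ _ _ v _ _ → v , ≼-refl , tt) , (λ w _ _ _ _ → w , ≼-refl , tt) , (λ _ _ _ _ ()) ,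
  (λ _ _ v' _ _ → v' , tt , ≼-refl) , (λ _ _ v' _ _ → v' , tt , ≼-refl)
  where open Model M

-- For Σ' = [] all worlds are bisimilar, and the
-- general code would not fit into tower (n + 2) 0.
mainTheorem16 : ExcludedMiddle (lsuc 0ℓ) →
    (M : Model) → ForestLike M →
    (n : ℕ) → HasDepth M n →
    (Σ' : List Formula) → Unique Σ' →
    (s : ℕ) → length Σ' ≡ s →
    QuotientCardLe M Σ' (tower (n + 2) (2 * (n + 1) * s))
mainTheorem16 em M forest n (_ , no-long-chain) [] _ _ refl =
  classes-bounded-by-code (trivial-strongBisim M) (λ _ → fzero) (λ _ → tt) (2^≤tower[n+2] n z≤n)
mainTheorem16 em M forest n (_ , no-long-chain) Σ'@(_ ∷ _) _ _ refl =
  classes-bounded-by-code related-strongBisim (encode ∘ code) (λ eq → code-≡⇒Related (encode-injective eq))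
    (2^≤tower[n+2] n (codeWidth≤tower _ n))
  where open Bisimulation (em⇒decide em) M forest n no-long-chain Σ'
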